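{- Let $T$ be a tree with $n\ge 2$ vertices containing $N_1\ge 2$ pendent vertices (vertices of degree $1$). Then $S(T)=\frac{2(n-2)}{n}N_1$.
   Context: For a graph with $n$ vertices, $m$ edges and degrees $d_1,\dots,d_n$, $S(G)=\sum_i|d_i-\frac{2m}{n}|$. -}

module Defs where

open import Data.Nat using (ℕ; zero; suc; _<_; _≤_; NonZero)
open import Data.Nat.Properties using (_<?_)
open import Data.Bool using (Bool; true; false; if_then_else_)
open import Data.Fin using (Fin; toℕ)
open import Data.List using (List; []; _∷_; _++_; [_]; length; map; allFin; foldr)
open import Data.Nat.ListAction using (sum)
open import Data.List.Relation.Unary.Unique.Propositional using (Unique)
open import Data.Product using (Σ; _×_; ∃)
open import Relation.Binary.PropositionalEquality using (_≡_)
open import Relation.Nullary using (¬_)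
open import Data.Integer using (+_)
open import Data.Rational using (ℚ; _/_; _-_; ∣_∣)
import Data.Rational as ℚ

record Graph (n : ℕ) : Set where
  field
    adj   : Fin n → Fin n → Bool
    sym   : ∀ i j → adj i j ≡ adj j i
    irrefl : ∀ i → adj i i ≡ false
open Graph public

degree : ∀ {n} → Graph n → Fin n → ℕ
degree {n} G i = sum (map (λ j → if adj G i j then 1 else 0) (allFin n))

edgeCount : ∀ {n} → Graph n → ℕ
edgeCount {n} G =
  sum (map (λ i → sum (map (λ j → if adj G i j then (if (toℕ i <ᵇ toℕ j) then 1 else 0) else 0) (allFin n))) (allFin n))
  where
  open import Data.Nat using (_<ᵇ_)

data Walk {n} (G : Graph n) : Fin n → Fin n → Set where
  here  : ∀ {u} → Walk G u u
  step  : ∀ {u w v} → adj G u w ≡ true → Walk G w v → Walk G u v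

Connected : ∀ {n} → Graph n → Set
Connected G = ∀ u v → Walk G u v

data AdjChain {n} (G : Graph n) : List (Fin n) → Set where
  []  : AdjChain G []
  [-] : ∀ {v} → AdjChain G (v ∷ [])
  _∷_ : ∀ {u v vs} → adj G u v ≡ true → AdjChain G (v ∷ vs) → AdjChain G (u ∷ v ∷ vs)

IsCycle : ∀ {n} → Graph n → List (Fin n) → Set
IsCycle G [] = Data.Empty.⊥
  where import Data.Empty
IsCycle G (v ∷ vs) = (3 ≤ length (v ∷ vs)) × Unique (v ∷ vs) × AdjChain G ((v ∷ vs) ++ [ v ])

Acyclic : ∀ {n} → Graph n → Set
Acyclic G = ∀ vs → ¬ IsCycle G vs

IsTree : ∀ {n} → Graph n → Set
IsTree G = Connected G × Acyclic G

pendentCount : ∀ {n} → Graph n → ℕ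
pendentCount {n} G = sum (map (λ i → if degree G i ≡ᵇ 1 then 1 else 0) (allFin n))
  where open import Data.Nat using (_≡ᵇ_)

sumℚ : List ℚ → ℚ
sumℚ = foldr ℚ._+_ ℚ.0ℚ

S : ∀ {n} .{{_ : NonZero n}} → Graph n → ℚ
S {n} G = sumℚ (map (λ i → ∣ (+ degree G i / 1) - (+ (2 Data.Nat.* edgeCount G) / n) ∣) (allFin n))
  where import Data.Nat

-- Every vertex of a tree T on n ≥ 2 vertices has degree at least 1, and the degrees sum
-- to 2(n - 1): removing a leaf leaves a tree, and a leaf exists because a path that
-- cannot be extended in an acyclic graph ends in one.  So the mean degree μ = 2(n - 1)/n
-- lies in [1, 2], whence |d - μ| = d - μ for d ≥ 2, while |1 - μ| = (1 - μ) + 2(μ - 1).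
-- Summing over the vertices, the signed deviations cancel and S(T) = 2(μ - 1) N₁.
module Submission where

open import Defs hiding (sym; irrefl)
open import Algebra.Bundles using (CommutativeRing)
import Algebra.Properties.CommutativeMonoid.Sum
import Algebra.Properties.Semiring.Sum
open import Data.Bool using (Bool; true; false; if_then_else_)
import Data.Bool as Bool
open import Data.Empty using (⊥; ⊥-elim)
open import Data.Fin using (Fin; zero; suc; toℕ; punchIn; punchOut)
import Data.Fin.Properties as Fin
open import Data.Integer using (+_)
import Data.Integer as ℤ
import Data.Integer.Properties as ℤ
open import Data.List using (List; []; _∷_; _++_; [_]; length; map; lookup; foldr; allFin; tabulate)
open import Data.List.Properties using (map-tabulate; map-++; length-map)
open import Data.List.Membership.Propositional using (_∈_)
open import Data.List.Membership.Propositional.Properties using (∈-lookup)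
open import Data.List.Relation.Unary.All using ([]; _∷_)
import Data.List.Relation.Unary.All as All
import Data.List.Relation.Unary.All.Properties as All
open import Data.List.Relation.Unary.AllPairs using ([]; _∷_)
open import Data.List.Relation.Unary.Any using (here; there)
open import Data.List.Relation.Unary.Unique.Propositional using (Unique)
import Data.List.Relation.Unary.Unique.Propositional.Properties as Unique
open import Data.Nat using (ℕ; zero; suc; _+_; _*_; _∸_; _≤_; _<_; _<ᵇ_; _≡ᵇ_; z≤n; s≤s; NonZero)
open import Data.Nat.Properties
open import Data.Product using (_×_; _,_; proj₂; ∃-syntax)
open import Data.Rational using (ℚ; _/_; toℚᵘ; 0ℚ; 1ℚ; ∣_∣; Positive)
import Data.Rational as ℚ
import Data.Rational.Properties as ℚ
open import Data.Rational.Solver using (module +-*-Solver)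
open import Data.Rational.Unnormalised using (mkℚᵘ; *≡*)
import Data.Rational.Unnormalised as ℚᵘ
import Data.Rational.Unnormalised.Properties as ℚᵘ
import Data.Vec.Functional as Vector
open import Function using (id; _∘_)
open import Relation.Binary.PropositionalEquality hiding ([_])
open import Relation.Nullary using (yes; no; ¬?; ofʸ; ofⁿ)
open import Relation.Nullary.Decidable using (_×-dec_)

open Algebra.Properties.CommutativeMonoid.Sum +-0-commutativeMonoid
module ℚΣ = Algebra.Properties.Semiring.Sum (CommutativeRing.semiring ℚ.+-*-commutativeRing)
open +-*-Solver using (solve; _:=_; con; _:+_; _:*_; _:-_; :-_)

-- Sums over Fin n

foldr-tabulate : ∀ {A B : Set} (g : A → B → B) (z : B) {n} (f : Fin n → A) →
                 foldr g z (tabulate f) ≡ Vector.foldr g z f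
foldr-tabulate g z {zero}  f = refl
foldr-tabulate g z {suc n} f = cong (g (f zero)) (foldr-tabulate g z (f ∘ suc))

foldr-map-allFin : ∀ {A B : Set} (g : A → B → B) (z : B) {n} (f : Fin n → A) →
                   foldr g z (map f (allFin n)) ≡ Vector.foldr g z f
foldr-map-allFin g z {n} f = trans (cong (foldr g z) (map-tabulate id f)) (foldr-tabulate g z f)

term≤∑ : ∀ {n} (f : Fin n → ℕ) i → f i ≤ ∑[ j < n ] f j
term≤∑ {suc n} f i = ≤-trans (m≤m+n (f i) _) (≤-reflexive (sym (sum-remove {i = i} f)))

-- Degrees and the handshake lemma

indicator : Bool → ℕ
indicator b = if b then 1 else 0

degree-∑ : ∀ {n} (G : Graph n) i → degree G i ≡ ∑[ j < n ] indicator (adj G i j)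
degree-∑ G i = foldr-map-allFin _+_ 0 (indicator ∘ adj G i)

forwardEdge : ∀ {n} → Graph n → Fin n → Fin n → ℕ
forwardEdge G i j = if adj G i j then indicator (toℕ i <ᵇ toℕ j) else 0

edgeCount-∑ : ∀ {n} (G : Graph n) → edgeCount G ≡ ∑[ i < n ] ∑[ j < n ] forwardEdge G i j
edgeCount-∑ {n} G =
  trans (foldr-map-allFin _+_ 0 (λ i → foldr _+_ 0 (map (forwardEdge G i) (allFin n))))
        (sum-cong-≗ (λ i → foldr-map-allFin _+_ 0 (forwardEdge G i)))

<ᵇ-split : ∀ {m n} → m ≢ n → indicator (m <ᵇ n) + indicator (n <ᵇ m) ≡ 1
<ᵇ-split {m} {n} m≢n with m <ᵇ n | <ᵇ-reflects-< m n | n <ᵇ m | <ᵇ-reflects-< n m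
... | true  | ofʸ m<n | true  | ofʸ n<m = ⊥-elim (<-asym m<n n<m)
... | true  | _       | false | _       = refl
... | false | _       | true  | _       = refl
... | false | ofⁿ m≮n | false | ofⁿ n≮m = ⊥-elim (m≢n (≤-antisym (≮⇒≥ n≮m) (≮⇒≥ m≮n)))

adjacent⇒≢ : ∀ {n} (G : Graph n) {i j} → adj G i j ≡ true → i ≢ j
adjacent⇒≢ G {i} i~j refl with trans (sym i~j) (Graph.irrefl G i)
... | ()

adjacency-split : ∀ {n} (G : Graph n) i j →
                  indicator (adj G i j) ≡ forwardEdge G i j + forwardEdge G j i
adjacency-split G i j with adj G i j in i~j
... | false rewrite Graph.sym G j i | i~j = refl
... | true  rewrite Graph.sym G j i | i~j =
  sym (<ᵇ-split (adjacent⇒≢ G i~j ∘ Fin.toℕ-injective))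

handshake : ∀ {n} (G : Graph n) → ∑[ i < n ] degree G i ≡ 2 * edgeCount G
handshake {n} G = begin
  ∑[ i < n ] degree G i
    ≡⟨ sum-cong-≗ (degree-∑ G) ⟩
  ∑[ i < n ] ∑[ j < n ] indicator (adj G i j)
    ≡⟨ sum-cong-≗ (λ i → sum-cong-≗ (adjacency-split G i)) ⟩
  ∑[ i < n ] ∑[ j < n ] (e i j + e j i)
    ≡⟨ sum-cong-≗ (λ i → ∑-distrib-+ (e i) (λ j → e j i)) ⟩
  ∑[ i < n ] (∑[ j < n ] e i j + ∑[ j < n ] e j i)
    ≡⟨ ∑-distrib-+ (λ i → ∑[ j < n ] e i j) (λ i → ∑[ j < n ] e j i) ⟩
  m + ∑[ i < n ] ∑[ j < n ] e j i
    ≡⟨ cong (_+_ m) (∑-comm (λ i j → e j i)) ⟩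
  m + m
    ≡⟨ cong (_+_ m) (sym (+-identityʳ m)) ⟩
  2 * m
    ≡⟨ cong (2 *_) (sym (edgeCount-∑ G)) ⟩
  2 * edgeCount G ∎
  where
  open ≡-Reasoning
  e : Fin n → Fin n → ℕ
  e = forwardEdge G
  m : ℕ
  m = ∑[ i < n ] ∑[ j < n ] e i j

module _ {m} (G : Graph (suc m)) where

  degree-punchIn : ∀ i v →
    degree G i ≡ indicator (adj G i v) + ∑[ j < m ] indicator (adj G i (punchIn v j))
  degree-punchIn i v = trans (degree-∑ G i) (sum-remove {i = v} (indicator ∘ adj G i))

  adjacent⇒degree≥1 : ∀ {i w} → adj G i w ≡ true → 1 ≤ degree G i
  adjacent⇒degree≥1 {i} {w} i~w rewrite degree-punchIn i w | i~w = s≤s z≤n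

  two-neighbours⇒degree≥2 : ∀ {v x y} → adj G v x ≡ true → adj G v y ≡ true → x ≢ y →
                            2 ≤ degree G v
  two-neighbours⇒degree≥2 {v} {x} {y} v~x v~y x≢y = begin
    2
      ≡⟨ cong₂ _+_ (cong indicator (sym v~x)) (cong indicator (sym v~y′)) ⟩
    indicator (adj G v x) + indicator (adj G v (punchIn x j))
      ≤⟨ +-monoʳ-≤ (indicator (adj G v x)) (term≤∑ (indicator ∘ adj G v ∘ punchIn x) j) ⟩
    indicator (adj G v x) + ∑[ j < m ] indicator (adj G v (punchIn x j))
      ≡⟨ sym (degree-punchIn v x) ⟩
    degree G v ∎
    where
    open ≤-Reasoning
    j : Fin m
    j = punchOut x≢y
    v~y′ : adj G v (punchIn x j) ≡ true
    v~y′ = trans (cong (adj G v) (Fin.punchIn-punchOut x≢y)) v~y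

  leaf-neighbour-unique : ∀ {v x y} → degree G v ≡ 1 →
                          adj G v x ≡ true → adj G v y ≡ true → x ≡ y
  leaf-neighbour-unique {x = x} {y} leaf v~x v~y with x Fin.≟ y
  ... | yes x≡y = x≡y
  ... | no  x≢y = ⊥-elim (<-irrefl (sym leaf) (two-neighbours⇒degree≥2 v~x v~y x≢y))

  unique-neighbour⇒leaf : ∀ {x z} → adj G x z ≡ true → (∀ y → adj G x y ≡ true → y ≡ z) →
                          degree G x ≡ 1
  unique-neighbour⇒leaf {x} {z} x~z only = begin
    degree G x
      ≡⟨ degree-punchIn x z ⟩
    indicator (adj G x z) + ∑[ j < m ] indicator (adj G x (punchIn z j))
      ≡⟨ cong₂ _+_ (cong indicator x~z) (trans (sum-cong-≗ no-other) (sum-replicate-zero m)) ⟩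
    1 ∎
    where
    open ≡-Reasoning
    no-other : ∀ j → indicator (adj G x (punchIn z j)) ≡ 0
    no-other j with adj G x (punchIn z j) in x~j
    ... | false = refl
    ... | true  = ⊥-elim (Fin.punchInᵢ≢i z j (only _ x~j))

-- Trees: leaves and the degree sum

unique-lookup-injective : ∀ {A : Set} {xs : List A} → Unique xs →
                          ∀ {i j} → lookup xs i ≡ lookup xs j → i ≡ j
unique-lookup-injective (x∉xs ∷ u) {zero}  {zero}  _  = refl
unique-lookup-injective (x∉xs ∷ u) {zero}  {suc j} eq = ⊥-elim (All.lookup x∉xs (∈-lookup j) eq)
unique-lookup-injective (x∉xs ∷ u) {suc i} {zero}  eq = ⊥-elim (All.lookup x∉xs (∈-lookup i) (sym eq))
unique-lookup-injective (x∉xs ∷ u) {suc i} {suc j} eq = cong suc (unique-lookup-injective u eq)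

unique⇒length≤ : ∀ {n} {xs : List (Fin n)} → Unique xs → length xs ≤ n
unique⇒length≤ {n} {xs} u with length xs ≤? n
... | yes ≤n = ≤n
... | no  ≰n with Fin.pigeonhole (≰⇒> ≰n) (lookup xs)
...   | i , j , i<j , eq = ⊥-elim (Fin.<⇒≢ i<j (unique-lookup-injective u eq))

Unique-++⁻ˡ : ∀ {A : Set} (xs : List A) {ys} → Unique (xs ++ ys) → Unique xs
Unique-++⁻ˡ []       u          = []
Unique-++⁻ˡ (x ∷ xs) (x∉ ∷ u) = All.++⁻ˡ xs x∉ ∷ Unique-++⁻ˡ xs u

module _ {n} (G : Graph n) where

  adj-sym : ∀ {i j} → adj G i j ≡ true → adj G j i ≡ true
  adj-sym {i} {j} i~j = trans (Graph.sym G j i) i~j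

  walk⇒neighbour : ∀ {u v} → Walk G u v → u ≢ v → ∃[ w ] adj G u w ≡ true
  walk⇒neighbour here                 u≢u = ⊥-elim (u≢u refl)
  walk⇒neighbour (step {w = w} u~w _) _   = w , u~w

  chain-prefix : ∀ {z x y rest} → AdjChain G (z ∷ rest) → y ∈ rest → adj G y x ≡ true →
                 ∃[ q ] ∃[ qs ] ∃[ s ] rest ≡ q ∷ qs ++ s × AdjChain G (z ∷ q ∷ qs ++ [ x ])
  chain-prefix {rest = r ∷ rs} (z~r ∷ c) (here refl)  y~x = r , [] , rs , refl , z~r ∷ y~x ∷ [-]
  chain-prefix {rest = r ∷ rs} (z~r ∷ c) (there y∈rs) y~x with chain-prefix c y∈rs y~x
  ... | q , qs , s , refl , c′ = r , q ∷ qs , s , refl , z~r ∷ c′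

  -- The chord x ~ y closes the segment of the path from x to y into a cycle.
  acyclic⇒no-chord : Acyclic G → ∀ {x x₁ y rest} → Unique (x ∷ x₁ ∷ rest) →
                     AdjChain G (x ∷ x₁ ∷ rest) → y ∈ rest → adj G x y ≡ true → ⊥
  acyclic⇒no-chord acyclic u (x~x₁ ∷ c) y∈rest x~y with chain-prefix c y∈rest (adj-sym x~y)
  ... | q , qs , s , refl , c′ =
    acyclic (_ ∷ _ ∷ q ∷ qs) (s≤s (s≤s (s≤s z≤n)) , Unique-++⁻ˡ (_ ∷ _ ∷ q ∷ qs) u , x~x₁ ∷ c′)

module _ {m} (G : Graph (suc m)) (acyclic : Acyclic G) where
  open import Data.List.Membership.DecPropositional (Fin._≟_ {suc m}) using (_∈?_)

  -- Paths are listed from their growing end x.  A path that cannot be extended at x ends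
  -- in a leaf, since a second neighbour of x on the path would close a cycle; the fuel
  -- runs out only when the path is longer than the number of vertices, which is absurd.
  path-extends-to-leaf : ∀ fuel {x x₁ rest} → Unique (x ∷ x₁ ∷ rest) → AdjChain G (x ∷ x₁ ∷ rest) →
                         suc m < length (x ∷ x₁ ∷ rest) + fuel → ∃[ v ] degree G v ≡ 1
  path-extends-to-leaf zero u c long =
    ⊥-elim (<⇒≱ (subst (suc m <_) (+-identityʳ _) long) (unique⇒length≤ u))
  path-extends-to-leaf (suc fuel) {x} {x₁} {rest} u c@(x~x₁ ∷ _) long
    with Fin.any? (λ y → (adj G x y Bool.≟ true) ×-dec ¬? (y ∈? (x ∷ x₁ ∷ rest)))
  ... | yes (y , x~y , y∉path) =
    path-extends-to-leaf fuel (All.¬Any⇒All¬ _ y∉path ∷ u) (adj-sym G x~y ∷ c)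
                         (subst (suc m <_) (+-suc _ fuel) long)
  ... | no stuck = x , unique-neighbour⇒leaf G x~x₁ only-x₁
    where
    only-x₁ : ∀ y → adj G x y ≡ true → y ≡ x₁
    only-x₁ y x~y with y ∈? (x ∷ x₁ ∷ rest)
    ... | no  y∉path                 = ⊥-elim (stuck (y , x~y , y∉path))
    ... | yes (here refl)            = ⊥-elim (adjacent⇒≢ G x~y refl)
    ... | yes (there (here refl))    = refl
    ... | yes (there (there y∈rest)) = ⊥-elim (acyclic⇒no-chord G acyclic u c y∈rest x~y)

tree-has-leaf : ∀ {k} (G : Graph (suc (suc k))) → IsTree G → ∃[ v ] degree G v ≡ 1
tree-has-leaf {k} G (connected , acyclic) with walk⇒neighbour G (connected zero (suc zero)) (λ ())
... | w , 0~w =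
  path-extends-to-leaf G acyclic (suc (suc k)) ((w≢0 ∷ []) ∷ [] ∷ []) (adj-sym G 0~w ∷ [-])
                       (m<n+m _ {2} (s≤s z≤n))
  where
  w≢0 : w ≢ zero
  w≢0 = adjacent⇒≢ G 0~w ∘ sym

removeVertex : ∀ {m} → Fin (suc m) → Graph (suc m) → Graph m
removeVertex v G = record
  { adj    = λ i j → adj G (punchIn v i) (punchIn v j)
  ; sym    = λ i j → Graph.sym G (punchIn v i) (punchIn v j)
  ; irrefl = λ i → Graph.irrefl G (punchIn v i)
  }

module _ {m} (G : Graph (suc m)) (v : Fin (suc m)) where

  private
    G-v : Graph m
    G-v = removeVertex v G

  degree-removeVertex : ∀ u → degree G (punchIn v u) ≡ indicator (adj G (punchIn v u) v) + degree G-v u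
  degree-removeVertex u =
    trans (degree-punchIn G (punchIn v u) v) (cong (_+_ (indicator (adj G (punchIn v u) v))) (sym (degree-∑ G-v u)))

  ∑-degree-removeVertex : ∑[ i < suc m ] degree G i ≡ 2 * degree G v + ∑[ u < m ] degree G-v u
  ∑-degree-removeVertex = begin
    ∑[ i < suc m ] degree G i
      ≡⟨ sum-remove {i = v} (degree G) ⟩
    d + ∑[ u < m ] degree G (punchIn v u)
      ≡⟨ cong (_+_ d) (sum-cong-≗ degree-removeVertex) ⟩
    d + ∑[ u < m ] (indicator (adj G (punchIn v u) v) + degree G-v u)
      ≡⟨ cong (_+_ d) (∑-distrib-+ (λ u → indicator (adj G (punchIn v u) v)) (degree G-v)) ⟩
    d + (∑[ u < m ] indicator (adj G (punchIn v u) v) + ∑[ u < m ] degree G-v u)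
      ≡⟨ cong (λ e → d + (e + ∑[ u < m ] degree G-v u)) back-edges ⟩
    d + (d + ∑[ u < m ] degree G-v u)
      ≡⟨ sym (+-assoc d d _) ⟩
    d + d + ∑[ u < m ] degree G-v u
      ≡⟨ cong (λ e → d + e + ∑[ u < m ] degree G-v u) (sym (+-identityʳ d)) ⟩
    2 * d + ∑[ u < m ] degree G-v u ∎
    where
    open ≡-Reasoning
    d : ℕ
    d = degree G v
    back-edges : ∑[ u < m ] indicator (adj G (punchIn v u) v) ≡ d
    back-edges = begin
      ∑[ u < m ] indicator (adj G (punchIn v u) v)
        ≡⟨ sum-cong-≗ (λ u → cong indicator (Graph.sym G (punchIn v u) v)) ⟩
      ∑[ u < m ] indicator (adj G v (punchIn v u))
        ≡⟨ cong (λ b → indicator b + ∑[ u < m ] indicator (adj G v (punchIn v u))) (sym (Graph.irrefl G v)) ⟩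
      indicator (adj G v v) + ∑[ u < m ] indicator (adj G v (punchIn v u))
        ≡⟨ sym (degree-punchIn G v v) ⟩
      d ∎

  removeVertex-acyclic : Acyclic G → Acyclic G-v
  removeVertex-acyclic acyclic (x ∷ xs) (long , u , c) = acyclic (map (punchIn v) (x ∷ xs))
    ( subst (3 ≤_) (sym (length-map (punchIn v) (x ∷ xs))) long
    , Unique.map⁺ (Fin.punchIn-injective v _ _) u
    , subst (AdjChain G) (map-++ (punchIn v) (x ∷ xs) [ x ]) (punchIn-chain c) )
    where
    punchIn-chain : ∀ {ys} → AdjChain G-v ys → AdjChain G (map (punchIn v) ys)
    punchIn-chain []       = []
    punchIn-chain [-]      = [-]
    punchIn-chain (e ∷ c′) = e ∷ punchIn-chain c′

  module _ (leaf : degree G v ≡ 1) where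

    -- A walk entering the leaf v must leave it at once through the vertex it came from,
    -- so both steps can be dropped.
    removeLeaf-walk : ∀ {x y} → Walk G x y → ∀ {a b} → x ≡ punchIn v a → y ≡ punchIn v b →
                      Walk G-v a b
    removeLeaf-walk here {a} x≡a y≡b =
      subst (Walk G-v a) (Fin.punchIn-injective v _ _ (trans (sym x≡a) y≡b)) here
    removeLeaf-walk (step {w = w} x~w rest) {a} x≡a y≡b with v Fin.≟ w
    ... | no v≢w = step a~w (removeLeaf-walk rest (sym (Fin.punchIn-punchOut v≢w)) y≡b)
      where
      a~w : adj G (punchIn v a) (punchIn v (punchOut v≢w)) ≡ true
      a~w rewrite Fin.punchIn-punchOut v≢w | sym x≡a = x~w
    ... | yes refl with rest
    ...   | here           = ⊥-elim (Fin.punchInᵢ≢i v _ (sym y≡b))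
    ...   | step v~z rest′ =
      removeLeaf-walk rest′ (trans (leaf-neighbour-unique G leaf v~z (adj-sym G x~w)) x≡a) y≡b

    removeLeaf-tree : IsTree G → IsTree G-v
    removeLeaf-tree (connected , acyclic) =
      (λ a b → removeLeaf-walk (connected (punchIn v a) (punchIn v b)) refl refl) ,
      removeVertex-acyclic acyclic

∑-degree-tree : ∀ k (G : Graph (suc k)) → IsTree G → ∑[ i < suc k ] degree G i ≡ 2 * k
∑-degree-tree zero    G _    = cong (λ b → indicator b + 0 + 0) (Graph.irrefl G zero)
∑-degree-tree (suc k) G tree with tree-has-leaf G tree
... | v , leaf = begin
  ∑[ i < suc (suc k) ] degree G i
    ≡⟨ ∑-degree-removeVertex G v ⟩
  2 * degree G v + ∑[ u < suc k ] degree (removeVertex v G) u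
    ≡⟨ cong₂ (λ d s → 2 * d + s) leaf (∑-degree-tree k (removeVertex v G) (removeLeaf-tree G v leaf tree)) ⟩
  2 + 2 * k
    ≡⟨ sym (*-suc 2 k) ⟩
  2 * suc k ∎
  where open ≡-Reasoning

tree-edgeCount : ∀ {k} (G : Graph (suc k)) → IsTree G → edgeCount G ≡ k
tree-edgeCount {k} G tree =
  *-cancelˡ-≡ (edgeCount G) k 2 (trans (sym (handshake G)) (∑-degree-tree k G tree))

connected⇒degree≥1 : ∀ {k} (G : Graph (suc (suc k))) → Connected G → ∀ i → 1 ≤ degree G i
connected⇒degree≥1 G connected i =
  adjacent⇒degree≥1 G (proj₂ (walk⇒neighbour G walk (Fin.punchInᵢ≢i i zero ∘ sym)))
  where
  walk : Walk G i (punchIn i zero)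
  walk = connected i (punchIn i zero)

-- Rational arithmetic

fromℕ : ℕ → ℚ
fromℕ a = + a / 1

toℚᵘ-/ : ∀ a j → toℚᵘ (+ a / suc j) ℚᵘ.≃ mkℚᵘ (+ a) j
toℚᵘ-/ a j = ℚ.toℚᵘ-fromℚᵘ (mkℚᵘ (+ a) j)

fromℕ-+ : ∀ a b → fromℕ (a + b) ≡ fromℕ a ℚ.+ fromℕ b
fromℕ-+ a b = ℚ.toℚᵘ-injective (begin
  toℚᵘ (fromℕ (a + b))                ≈⟨ toℚᵘ-/ (a + b) 0 ⟩
  mkℚᵘ (+ (a + b)) 0                  ≈⟨ *≡* (cong (λ z → z ℤ.* + 1) numerators) ⟩
  mkℚᵘ (+ a) 0 ℚᵘ.+ mkℚᵘ (+ b) 0      ≈⟨ ℚᵘ.≃-sym (ℚᵘ.+-cong (toℚᵘ-/ a 0) (toℚᵘ-/ b 0)) ⟩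
  toℚᵘ (fromℕ a) ℚᵘ.+ toℚᵘ (fromℕ b)  ≈⟨ ℚᵘ.≃-sym (ℚ.toℚᵘ-homo-+ (fromℕ a) (fromℕ b)) ⟩
  toℚᵘ (fromℕ a ℚ.+ fromℕ b)          ∎)
  where
  open ℚᵘ.≃-Reasoning
  numerators : + (a + b) ≡ + a ℤ.* + 1 ℤ.+ + b ℤ.* + 1
  numerators = trans (ℤ.pos-+ a b) (sym (cong₂ ℤ._+_ (ℤ.*-identityʳ (+ a)) (ℤ.*-identityʳ (+ b))))

fromℕ-* : ∀ a b → fromℕ (a * b) ≡ fromℕ a ℚ.* fromℕ b
fromℕ-* a b = ℚ.toℚᵘ-injective (begin
  toℚᵘ (fromℕ (a * b))                ≈⟨ toℚᵘ-/ (a * b) 0 ⟩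
  mkℚᵘ (+ (a * b)) 0                  ≈⟨ *≡* (cong (λ z → z ℤ.* + 1) (ℤ.pos-* a b)) ⟩
  mkℚᵘ (+ a) 0 ℚᵘ.* mkℚᵘ (+ b) 0      ≈⟨ ℚᵘ.≃-sym (ℚᵘ.*-cong (toℚᵘ-/ a 0) (toℚᵘ-/ b 0)) ⟩
  toℚᵘ (fromℕ a) ℚᵘ.* toℚᵘ (fromℕ b)  ≈⟨ ℚᵘ.≃-sym (ℚ.toℚᵘ-homo-* (fromℕ a) (fromℕ b)) ⟩
  toℚᵘ (fromℕ a ℚ.* fromℕ b)          ∎)
  where open ℚᵘ.≃-Reasoning

/-*-cancel : ∀ a j → (+ a / suc j) ℚ.* fromℕ (suc j) ≡ fromℕ a
/-*-cancel a j = ℚ.toℚᵘ-injective (begin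
  toℚᵘ ((+ a / suc j) ℚ.* fromℕ (suc j))         ≈⟨ ℚ.toℚᵘ-homo-* (+ a / suc j) (fromℕ (suc j)) ⟩
  toℚᵘ (+ a / suc j) ℚᵘ.* toℚᵘ (fromℕ (suc j))  ≈⟨ ℚᵘ.*-cong (toℚᵘ-/ a j) (toℚᵘ-/ (suc j) 0) ⟩
  mkℚᵘ (+ a) j ℚᵘ.* mkℚᵘ (+ suc j) 0            ≈⟨ *≡* cross-product ⟩
  mkℚᵘ (+ a) 0                                   ≈⟨ ℚᵘ.≃-sym (toℚᵘ-/ a 0) ⟩
  toℚᵘ (fromℕ a)                                 ∎)
  where
  open ℚᵘ.≃-Reasoning
  cross-product : (+ a ℤ.* + suc j) ℤ.* + 1 ≡ + a ℤ.* + suc (j * 1)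
  cross-product = trans (ℤ.*-identityʳ _) (cong (λ z → + a ℤ.* + suc z) (sym (*-identityʳ j)))

fromℕ-nonNeg : ∀ a → 0ℚ ℚ.≤ fromℕ a
fromℕ-nonNeg a = ℚ.nonNegative⁻¹ (fromℕ a) {{ℚ.normalize-nonNeg a 1}}

fromℕ-mono-≤ : ∀ {a b} → a ≤ b → fromℕ a ℚ.≤ fromℕ b
fromℕ-mono-≤ {a} {b} a≤b = begin
  fromℕ a                    ≡⟨ sym (ℚ.+-identityʳ (fromℕ a)) ⟩
  fromℕ a ℚ.+ 0ℚ             ≤⟨ ℚ.+-monoʳ-≤ (fromℕ a) (fromℕ-nonNeg (b ∸ a)) ⟩
  fromℕ a ℚ.+ fromℕ (b ∸ a)  ≡⟨ sym (fromℕ-+ a (b ∸ a)) ⟩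
  fromℕ (a + (b ∸ a))        ≡⟨ cong fromℕ (m+[n∸m]≡n a≤b) ⟩
  fromℕ b                    ∎
  where open ℚ.≤-Reasoning

*-cancelʳ-fromℕ : ∀ {p q} j → p ℚ.* fromℕ (suc j) ≡ q ℚ.* fromℕ (suc j) → p ≡ q
*-cancelʳ-fromℕ j eq =
  ℚ.≤-antisym (ℚ.*-cancelʳ-≤-pos r (ℚ.≤-reflexive eq)) (ℚ.*-cancelʳ-≤-pos r (ℚ.≤-reflexive (sym eq)))
  where
  r : ℚ
  r = fromℕ (suc j)
  instance
    r-pos : Positive r
    r-pos = ℚ.normalize-pos (suc j) 1

fromℕ-∑ : ∀ {n} (f : Fin n → ℕ) → ℚΣ.sum (fromℕ ∘ f) ≡ fromℕ (∑[ i < n ] f i)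
fromℕ-∑ {zero}  f = refl
fromℕ-∑ {suc n} f = trans (cong (fromℕ (f zero) ℚ.+_) (fromℕ-∑ (f ∘ suc))) (sym (fromℕ-+ (f zero) _))

∑-const : ∀ n p → ℚΣ.sum {n} (λ _ → p) ≡ fromℕ n ℚ.* p
∑-const zero    p = sym (ℚ.*-zeroˡ p)
∑-const (suc n) p = begin
  p ℚ.+ ℚΣ.sum {n} (λ _ → p)  ≡⟨ cong (p ℚ.+_) (∑-const n p) ⟩
  p ℚ.+ fromℕ n ℚ.* p         ≡⟨ solve 2 (λ x p → p :+ x :* p := (con 1ℚ :+ x) :* p) refl (fromℕ n) p ⟩
  (1ℚ ℚ.+ fromℕ n) ℚ.* p      ≡⟨ cong (ℚ._* p) (sym (fromℕ-+ 1 n)) ⟩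
  fromℕ (suc n) ℚ.* p         ∎
  where open ≡-Reasoning

p≤q⇒0≤q-p : ∀ {p q} → p ℚ.≤ q → 0ℚ ℚ.≤ q ℚ.- p
p≤q⇒0≤q-p {p} {q} p≤q = begin
  0ℚ       ≡⟨ sym (ℚ.+-inverseʳ p) ⟩
  p ℚ.- p  ≤⟨ ℚ.+-monoˡ-≤ (ℚ.- p) p≤q ⟩
  q ℚ.- p  ∎
  where open ℚ.≤-Reasoning

leafIndicator : ℕ → ℕ
leafIndicator d = indicator (d ≡ᵇ 1)

∣d-μ∣ : ∀ {d} μ → 1 ≤ d → 1ℚ ℚ.≤ μ → μ ℚ.≤ fromℕ 2 →
        ∣ fromℕ d ℚ.- μ ∣ ≡ (fromℕ d ℚ.- μ) ℚ.+ fromℕ (leafIndicator d) ℚ.* (fromℕ 2 ℚ.* (μ ℚ.- 1ℚ))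
∣d-μ∣ {suc zero} μ _ 1≤μ _ = begin
  ∣ 1ℚ ℚ.- μ ∣
    ≡⟨ cong ∣_∣ (solve 1 (λ μ → con 1ℚ :- μ := :- (μ :- con 1ℚ)) refl μ) ⟩
  ∣ ℚ.- (μ ℚ.- 1ℚ) ∣
    ≡⟨ ℚ.∣-p∣≡∣p∣ (μ ℚ.- 1ℚ) ⟩
  ∣ μ ℚ.- 1ℚ ∣
    ≡⟨ ℚ.0≤p⇒∣p∣≡p (p≤q⇒0≤q-p 1≤μ) ⟩
  μ ℚ.- 1ℚ
    ≡⟨ solve 1 (λ μ → μ :- con 1ℚ := (con 1ℚ :- μ) :+ con 1ℚ :* ((con 1ℚ :+ con 1ℚ) :* (μ :- con 1ℚ))) refl μ ⟩
  (1ℚ ℚ.- μ) ℚ.+ 1ℚ ℚ.* (fromℕ 2 ℚ.* (μ ℚ.- 1ℚ)) ∎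
  where open ≡-Reasoning
∣d-μ∣ {suc (suc e)} μ _ _ μ≤2 = begin
  ∣ d ℚ.- μ ∣
    ≡⟨ ℚ.0≤p⇒∣p∣≡p (p≤q⇒0≤q-p (ℚ.≤-trans μ≤2 (fromℕ-mono-≤ {2} {2 + e} (s≤s (s≤s z≤n))))) ⟩
  d ℚ.- μ
    ≡⟨ solve 2 (λ x c → x := x :+ con 0ℚ :* c) refl (d ℚ.- μ) (fromℕ 2 ℚ.* (μ ℚ.- 1ℚ)) ⟩
  (d ℚ.- μ) ℚ.+ 0ℚ ℚ.* (fromℕ 2 ℚ.* (μ ℚ.- 1ℚ)) ∎
  where
  open ≡-Reasoning
  d : ℚ
  d = fromℕ (suc (suc e))

mean-absolute-deviation : ∀ {n} (d : Fin n → ℕ) μ → (∀ i → 1 ≤ d i) → 1ℚ ℚ.≤ μ → μ ℚ.≤ fromℕ 2 →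
  fromℕ n ℚ.* μ ≡ fromℕ (∑[ i < n ] d i) →
  ℚΣ.sum (λ i → ∣ fromℕ (d i) ℚ.- μ ∣) ≡ fromℕ 2 ℚ.* (μ ℚ.- 1ℚ) ℚ.* fromℕ (∑[ i < n ] leafIndicator (d i))
mean-absolute-deviation {n} d μ d≥1 1≤μ μ≤2 mean = begin
  ℚΣ.sum (λ i → ∣ fromℕ (d i) ℚ.- μ ∣)
    ≡⟨ ℚΣ.sum-cong-≗ (λ i → ∣d-μ∣ μ (d≥1 i) 1≤μ μ≤2) ⟩
  ℚΣ.sum (λ i → (fromℕ (d i) ℚ.- μ) ℚ.+ fromℕ (ℓ i) ℚ.* c)
    ≡⟨ ℚΣ.∑-distrib-+ (λ i → fromℕ (d i) ℚ.- μ) (λ i → fromℕ (ℓ i) ℚ.* c) ⟩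
  ℚΣ.sum (λ i → fromℕ (d i) ℚ.- μ) ℚ.+ ℚΣ.sum (λ i → fromℕ (ℓ i) ℚ.* c)
    ≡⟨ cong₂ ℚ._+_ (ℚΣ.∑-distrib-+ (fromℕ ∘ d) (λ _ → ℚ.- μ)) (sym (ℚΣ.*-distribʳ-sum c (fromℕ ∘ ℓ))) ⟩
  (ℚΣ.sum (fromℕ ∘ d) ℚ.+ ℚΣ.sum {n} (λ _ → ℚ.- μ)) ℚ.+ L ℚ.* c
    ≡⟨ cong₂ (λ s t → (s ℚ.+ t) ℚ.+ L ℚ.* c) (trans (fromℕ-∑ d) (sym mean)) (∑-const n (ℚ.- μ)) ⟩
  (fromℕ n ℚ.* μ ℚ.+ fromℕ n ℚ.* ℚ.- μ) ℚ.+ L ℚ.* c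
    ≡⟨ solve 4 (λ n μ L c → (n :* μ :+ n :* (:- μ)) :+ L :* c := c :* L) refl (fromℕ n) μ L c ⟩
  c ℚ.* L
    ≡⟨ cong (c ℚ.*_) (fromℕ-∑ ℓ) ⟩
  c ℚ.* fromℕ (∑[ i < n ] ℓ i) ∎
  where
  open ≡-Reasoning
  ℓ : Fin n → ℕ
  ℓ = leafIndicator ∘ d
  c : ℚ
  c = fromℕ 2 ℚ.* (μ ℚ.- 1ℚ)
  L : ℚ
  L = ℚΣ.sum (fromℕ ∘ ℓ)

module TreeMean (k : ℕ) where

  private
    n : ℕ
    n = suc (suc k)
    instance
      n-pos : Positive (fromℕ n)
      n-pos = ℚ.normalize-pos n 1

  μ : ℚ
  μ = + (2 * suc k) / n

  n*μ : fromℕ n ℚ.* μ ≡ fromℕ (2 * suc k)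
  n*μ = trans (ℚ.*-comm (fromℕ n) μ) (/-*-cancel (2 * suc k) (suc k))

  1≤μ : 1ℚ ℚ.≤ μ
  1≤μ = ℚ.*-cancelʳ-≤-pos (fromℕ n) (begin
    1ℚ ℚ.* fromℕ n     ≡⟨ ℚ.*-identityˡ (fromℕ n) ⟩
    fromℕ n            ≤⟨ fromℕ-mono-≤ (subst (n ≤_) (sym (*-suc 2 k)) (+-monoʳ-≤ 2 (m≤n*m k 2))) ⟩
    fromℕ (2 * suc k)  ≡⟨ sym (/-*-cancel (2 * suc k) (suc k)) ⟩
    μ ℚ.* fromℕ n      ∎)
    where open ℚ.≤-Reasoning

  μ≤2 : μ ℚ.≤ fromℕ 2
  μ≤2 = ℚ.*-cancelʳ-≤-pos (fromℕ n) (begin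
    μ ℚ.* fromℕ n        ≡⟨ /-*-cancel (2 * suc k) (suc k) ⟩
    fromℕ (2 * suc k)    ≤⟨ fromℕ-mono-≤ (*-monoʳ-≤ 2 (n≤1+n (suc k))) ⟩
    fromℕ (2 * n)        ≡⟨ fromℕ-* 2 n ⟩
    fromℕ 2 ℚ.* fromℕ n  ∎)
    where open ℚ.≤-Reasoning

  2[μ-1] : fromℕ 2 ℚ.* (μ ℚ.- 1ℚ) ≡ + (2 * k) / n
  2[μ-1] = *-cancelʳ-fromℕ (suc k) (begin
    fromℕ 2 ℚ.* (μ ℚ.- 1ℚ) ℚ.* fromℕ n
      ≡⟨ solve 3 (λ t μ m → t :* (μ :- con 1ℚ) :* m := t :* (μ :* m) :- t :* m) refl (fromℕ 2) μ (fromℕ n) ⟩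
    fromℕ 2 ℚ.* (μ ℚ.* fromℕ n) ℚ.- fromℕ 2 ℚ.* fromℕ n
      ≡⟨ cong₂ (λ a b → fromℕ 2 ℚ.* a ℚ.- b) (/-*-cancel (2 * suc k) (suc k)) (sym (fromℕ-* 2 n)) ⟩
    fromℕ 2 ℚ.* fromℕ (2 * suc k) ℚ.- fromℕ (2 * n)
      ≡⟨ cong (ℚ._- fromℕ (2 * n)) (sym (fromℕ-* 2 (2 * suc k))) ⟩
    fromℕ (2 * (2 * suc k)) ℚ.- fromℕ (2 * n)
      ≡⟨ cong (λ a → fromℕ a ℚ.- fromℕ (2 * n)) 4[1+k]≡2n+2k ⟩
    fromℕ (2 * n + 2 * k) ℚ.- fromℕ (2 * n)
      ≡⟨ cong (ℚ._- fromℕ (2 * n)) (fromℕ-+ (2 * n) (2 * k)) ⟩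
    fromℕ (2 * n) ℚ.+ fromℕ (2 * k) ℚ.- fromℕ (2 * n)
      ≡⟨ solve 2 (λ a b → a :+ b :- a := b) refl (fromℕ (2 * n)) (fromℕ (2 * k)) ⟩
    fromℕ (2 * k)
      ≡⟨ sym (/-*-cancel (2 * k) (suc k)) ⟩
    (+ (2 * k) / n) ℚ.* fromℕ n ∎)
    where
    open ≡-Reasoning
    4[1+k]≡2n+2k : 2 * (2 * suc k) ≡ 2 * n + 2 * k
    4[1+k]≡2n+2k = trans (cong (2 *_) (trans (*-suc 2 k) (cong (λ m → 2 + (k + m)) (+-identityʳ k))))
                         (*-distribˡ-+ 2 n k)

proposition32 : (n : ℕ) .{{_ : NonZero n}} → 2 ≤ n → (T : Graph n) → IsTree T →
  2 ≤ pendentCount T →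
  S T ≡ (+ (2 * (n ∸ 2)) / n) ℚ.* (+ pendentCount T / 1)
proposition32 (suc (suc k)) (s≤s (s≤s z≤n)) T tree@(connected , _) _ = begin
  S T
    ≡⟨ foldr-map-allFin ℚ._+_ 0ℚ (λ i → ∣ fromℕ (degree T i) ℚ.- + (2 * edgeCount T) / n ∣) ⟩
  ℚΣ.sum (λ i → ∣ fromℕ (degree T i) ℚ.- + (2 * edgeCount T) / n ∣)
    ≡⟨ cong (λ m → ℚΣ.sum (λ i → ∣ fromℕ (degree T i) ℚ.- + (2 * m) / n ∣)) (tree-edgeCount T tree) ⟩
  ℚΣ.sum (λ i → ∣ fromℕ (degree T i) ℚ.- μ ∣)
    ≡⟨ mean-absolute-deviation (degree T) μ (connected⇒degree≥1 T connected) 1≤μ μ≤2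
         (trans n*μ (cong fromℕ (sym (∑-degree-tree (suc k) T tree)))) ⟩
  fromℕ 2 ℚ.* (μ ℚ.- 1ℚ) ℚ.* fromℕ (∑[ i < n ] leafIndicator (degree T i))
    ≡⟨ cong₂ ℚ._*_ 2[μ-1] (cong fromℕ (sym (foldr-map-allFin _+_ 0 (leafIndicator ∘ degree T)))) ⟩
  (+ (2 * k) / n) ℚ.* fromℕ (pendentCount T) ∎
  where
  open ≡-Reasoning
  open TreeMean k
  n : ℕ
  n = suc (suc k)
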